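{- For every integer $r\ge2$ and every $m\in\mathbb{N}$ there exist integers $a_{m,k}^{(r)}$ ($m\le k\le rm$), independent of $\ell$, such that for all $\ell\in\mathbb{N}$ $$\binom{\ell}{m}^r\binom{\ell+m}{m}^r=\sum_{k=m}^{rm}a_{m,k}^{(r)}\binom{\ell}{k}\binom{\ell+k}{k}.$$
   Context: $\mathbb{N}$ denotes the set of nonnegative integers. -}

module Defs where

open import Data.Nat using (ℕ; zero; suc; _+_; _∸_)
open import Data.Integer using (ℤ; 0ℤ) renaming (_+_ to _+ℤ_)

-- ∑[k=m..n] f = f m + f (m+1) + ... + f n   (empty, i.e. 0, when n < m)
sumFromTo : ℕ → ℕ → (ℕ → ℤ) → ℤ
sumFromTo m n f = go (suc n ∸ m) m
  where
  go : ℕ → ℕ → ℤ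
  go zero    i = 0ℤ
  go (suc c) i = f i +ℤ go c (suc i)

-- Write P k ℓ = C(ℓ,k) C(ℓ+k,k). The absorption identities for binomial coefficients give
-- (k+1)² P (k+1) = (ℓ(ℓ+1) − k(k+1)) P k, so multiplying an expansion Σ a k P k by
-- ℓ(ℓ+1) − m(m+1) gives an expansion again. Starting from P 0 = 1, induction on m with
-- this recurrence yields the linearisation formula
--   P m P n = Σ_{k ≤ m+n} C(k,m) C(k,n) C(m+n,k) P k,
-- whose coefficients are integers vanishing for k < m. Iterating it, P m ^ r is an integer
-- combination of the P k with m ≤ k ≤ r m.
module Submission where

module Linearisation where

  open import Algebra.Properties.CommutativeSemigroup using (x∙yz≈y∙xz)
  open import Data.Fin using (toℕ)
  open import Data.Fin.Properties using (toℕ<n; toℕ-inject₁; toℕ-fromℕ)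
  open import Data.Integer using (ℤ; +_; 0ℤ; 1ℤ; _+_; _-_; _*_)
  open import Data.Integer.Properties
    using ( +-*-semiring; *-commutativeSemigroup; +-identityˡ; +-identityʳ; +-assoc
          ; *-zeroʳ; *-assoc; *-distribʳ-+; *-cancelˡ-≡; pos-* )
  open import Data.Integer.Tactic.RingSolver using (solve)
  open import Data.List using (_∷_; [])
  open import Data.Nat as ℕ using (ℕ; zero; suc; _≤_; _<_; _∸_; s≤s)
  import Data.Nat.Properties as ℕ
  open import Data.Nat.Combinatorics using (_C_; nCk+nC[k+1]≡[n+1]C[k+1]; k>n⇒nCk≡0; nCn≡1; nC1≡n)
  open import Defs using (sumFromTo)
  open import Function using (_∘_)
  open import Relation.Binary.Definitions using (tri<; tri≈; tri>)
  open import Relation.Binary.PropositionalEquality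
  open import Relation.Nullary using (contradiction)
  open import Algebra.Properties.Semiring.Sum +-*-semiring
    using (sum; sum-cong-≗; sum-replicate-zero; sum-init-last; ∑-distrib-+; ∑-comm
          ; *-distribˡ-sum; *-distribʳ-sum)

  ∑< : ℕ → (ℕ → ℤ) → ℤ
  ∑< N f = sum {N} (λ i → f (toℕ i))

  ∑<-cong : ∀ {N} {f g : ℕ → ℤ} → (∀ k → k < N → f k ≡ g k) → ∑< N f ≡ ∑< N g
  ∑<-cong f≗g = sum-cong-≗ (λ i → f≗g (toℕ i) (toℕ<n i))

  ∑<-zero : ∀ {N} {f : ℕ → ℤ} → (∀ k → k < N → f k ≡ 0ℤ) → ∑< N f ≡ 0ℤ
  ∑<-zero {N} f≗0 = trans (∑<-cong f≗0) (sum-replicate-zero N)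

  ∑<-last : ∀ N (f : ℕ → ℤ) → ∑< (suc N) f ≡ ∑< N f + f N
  ∑<-last N f = trans (sum-init-last {N} (λ i → f (toℕ i)))
    (cong₂ _+_ (sum-cong-≗ {N} (λ i → cong f (toℕ-inject₁ i))) (cong f (toℕ-fromℕ N)))

  ∑<-single : ∀ {N} n (f : ℕ → ℤ) → n < N → (∀ k → k ≢ n → f k ≡ 0ℤ) → ∑< N f ≡ f n
  ∑<-single {suc N} zero f (s≤s _) off =
    trans (cong (λ s → f 0 + s) (∑<-zero {N} (λ k _ → off (suc k) λ ()))) (+-identityʳ (f 0))
  ∑<-single {suc N} (suc n) f (s≤s n<N) off =
    trans (cong (_+ ∑< N (f ∘ suc)) (off 0 λ ()))
      (trans (+-identityˡ _)
             (∑<-single n (f ∘ suc) n<N (λ k k≢n → off (suc k) (k≢n ∘ ℕ.suc-injective))))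

  sumFromTo-step : ∀ {m n} (f : ℕ → ℤ) → m ≤ n → sumFromTo m n f ≡ f m + sumFromTo (suc m) n f
  sumFromTo-step f m≤n rewrite ℕ.+-∸-assoc 1 m≤n = refl

  sumFromTo-empty : ∀ {m n} (f : ℕ → ℤ) → n < m → sumFromTo m n f ≡ 0ℤ
  sumFromTo-empty f n<m rewrite ℕ.m≤n⇒m∸n≡0 n<m = refl

  ∑<-split-sumFromTo : ∀ {n} (f : ℕ → ℤ) d m → d ℕ.+ m ≡ suc n →
                       ∑< (suc n) f ≡ ∑< m f + sumFromTo m n f
  ∑<-split-sumFromTo {n} f zero _ refl =
    sym (trans (cong (λ s → ∑< (suc n) f + s) (sumFromTo-empty f (ℕ.n<1+n n))) (+-identityʳ _))
  ∑<-split-sumFromTo {n} f (suc d) m d+m≡n = begin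
    ∑< (suc n) f                           ≡⟨ ∑<-split-sumFromTo f d (suc m) (trans (ℕ.+-suc d m) d+m≡n) ⟩
    ∑< (suc m) f + sumFromTo (suc m) n f   ≡⟨ cong (_+ sumFromTo (suc m) n f) (∑<-last m f) ⟩
    ∑< m f + f m + sumFromTo (suc m) n f   ≡⟨ +-assoc (∑< m f) (f m) _ ⟩
    ∑< m f + (f m + sumFromTo (suc m) n f) ≡⟨ cong (λ s → ∑< m f + s) (sumFromTo-step f m≤n) ⟨
    ∑< m f + sumFromTo m n f               ∎
    where
    open ≡-Reasoning
    m≤n : m ≤ n
    m≤n = subst (m ≤_) (ℕ.suc-injective d+m≡n) (ℕ.m≤n+m m d)

  ∑<-sumFromTo : ∀ {m n} (f : ℕ → ℤ) → m ≤ suc n → (∀ k → k < m → f k ≡ 0ℤ) →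
                 ∑< (suc n) f ≡ sumFromTo m n f
  ∑<-sumFromTo {m} {n} f m≤1+n below = begin
    ∑< (suc n) f             ≡⟨ ∑<-split-sumFromTo f (suc n ∸ m) m (ℕ.m∸n+n≡m m≤1+n) ⟩
    ∑< m f + sumFromTo m n f ≡⟨ cong (_+ sumFromTo m n f) (∑<-zero below) ⟩
    0ℤ + sumFromTo m n f     ≡⟨ +-identityˡ _ ⟩
    sumFromTo m n f          ∎
    where open ≡-Reasoning

  [1+k]*[1+n]C[1+k]≡[1+n]*nCk : ∀ n k → suc k ℕ.* (suc n C suc k) ≡ suc n ℕ.* (n C k)
  [1+k]*[1+n]C[1+k]≡[1+n]*nCk n zero =
    trans (ℕ.*-identityˡ _) (trans (nC1≡n (suc n)) (sym (ℕ.*-identityʳ (suc n))))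
  [1+k]*[1+n]C[1+k]≡[1+n]*nCk zero (suc k) = ℕ.*-zeroʳ (suc (suc k))
  [1+k]*[1+n]C[1+k]≡[1+n]*nCk (suc n) (suc k) = begin
    suc (suc k) ℕ.* (suc (suc n) C suc (suc k))
      ≡⟨ cong (suc (suc k) ℕ.*_) (nCk+nC[k+1]≡[n+1]C[k+1] (suc n) (suc k)) ⟨
    suc (suc k) ℕ.* (X ℕ.+ Y)
      ≡⟨ ℕ.*-distribˡ-+ (suc (suc k)) X Y ⟩
    X ℕ.+ suc k ℕ.* X ℕ.+ suc (suc k) ℕ.* Y
      ≡⟨ cong₂ (λ a b → X ℕ.+ a ℕ.+ b) ([1+k]*[1+n]C[1+k]≡[1+n]*nCk n k)
                                       ([1+k]*[1+n]C[1+k]≡[1+n]*nCk n (suc k)) ⟩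
    X ℕ.+ suc n ℕ.* (n C k) ℕ.+ suc n ℕ.* (n C suc k)
      ≡⟨ ℕ.+-assoc X (suc n ℕ.* (n C k)) _ ⟩
    X ℕ.+ (suc n ℕ.* (n C k) ℕ.+ suc n ℕ.* (n C suc k))
      ≡⟨ cong (X ℕ.+_) (ℕ.*-distribˡ-+ (suc n) (n C k) (n C suc k)) ⟨
    X ℕ.+ suc n ℕ.* (n C k ℕ.+ n C suc k)
      ≡⟨ cong (λ z → X ℕ.+ suc n ℕ.* z) (nCk+nC[k+1]≡[n+1]C[k+1] n k) ⟩
    suc (suc n) ℕ.* X
      ∎
    where
    open ≡-Reasoning
    X = suc n C suc k
    Y = suc n C suc (suc k)

  pos-*-≡ : ∀ a b c d → a ℕ.* b ≡ c ℕ.* d → + a * + b ≡ + c * + d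
  pos-*-≡ a b c d eq = trans (sym (pos-* a b)) (trans (cong +_ eq) (pos-* c d))

  [1+k]*nC[1+k]≡[n-k]*nCk : ∀ n k → + suc k * + (n C suc k) ≡ (+ n - + k) * + (n C k)
  [1+k]*nC[1+k]≡[n-k]*nCk n k = cancel (+ n) (+ k) (+ (n C k)) (+ (n C suc k))
    (trans (cong (λ z → + suc k * + z) (nCk+nC[k+1]≡[n+1]C[k+1] n k))
           (pos-*-≡ (suc k) (suc n C suc k) (suc n) (n C k) ([1+k]*[1+n]C[1+k]≡[1+n]*nCk n k)))
    where
    cancel : ∀ n k a b → (1ℤ + k) * (a + b) ≡ (1ℤ + n) * a → (1ℤ + k) * b ≡ (n - k) * a
    cancel n k a b eq = begin
      (1ℤ + k) * b                       ≡⟨ solve (n ∷ k ∷ a ∷ b ∷ []) ⟩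
      (1ℤ + k) * (a + b) - (1ℤ + k) * a  ≡⟨ cong (_- (1ℤ + k) * a) eq ⟩
      (1ℤ + n) * a - (1ℤ + k) * a        ≡⟨ solve (n ∷ k ∷ a ∷ b ∷ []) ⟩
      (n - k) * a                        ∎
      where open ≡-Reasoning

  [1+n]*nCk≡[1+n-k]*[1+n]Ck : ∀ n k → + suc n * + (n C k) ≡ (+ suc n - + k) * + (suc n C k)
  [1+n]*nCk≡[1+n-k]*[1+n]Ck n zero = cong (λ z → + z * 1ℤ) (sym (ℕ.+-identityʳ (suc n)))
  [1+n]*nCk≡[1+n-k]*[1+n]Ck n (suc k) =
    trans (widen (+ n) (+ k) (+ (n C k)) (+ (n C suc k)) ([1+k]*nC[1+k]≡[n-k]*nCk n k))
          (cong (λ z → (+ suc n - + suc k) * + z) (nCk+nC[k+1]≡[n+1]C[k+1] n k))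
    where
    widen : ∀ n k a b → (1ℤ + k) * b ≡ (n - k) * a →
            (1ℤ + n) * b ≡ (1ℤ + n - (1ℤ + k)) * (a + b)
    widen n k a b eq = begin
      (1ℤ + n) * b                   ≡⟨ solve (n ∷ k ∷ a ∷ b ∷ []) ⟩
      (1ℤ + k) * b + (n - k) * b     ≡⟨ cong (_+ (n - k) * b) eq ⟩
      (n - k) * a + (n - k) * b      ≡⟨ solve (n ∷ k ∷ a ∷ b ∷ []) ⟩
      (1ℤ + n - (1ℤ + k)) * (a + b)  ∎
      where open ≡-Reasoning

  P : ℕ → ℕ → ℤ
  P k ℓ = + ((ℓ C k) ℕ.* ((ℓ ℕ.+ k) C k))

  pronic : ℕ → ℤ
  pronic n = + n * + suc n

  P-recurrence : ∀ k ℓ → + suc k * + suc k * P (suc k) ℓ ≡ (pronic ℓ - pronic k) * P k ℓ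
  P-recurrence k ℓ = begin
    + suc k * + suc k * P (suc k) ℓ
      ≡⟨ cong (+ suc k * + suc k *_) (pos-* (ℓ C suc k) _) ⟩
    + suc k * + suc k * (+ (ℓ C suc k) * + ((ℓ ℕ.+ suc k) C suc k))
      ≡⟨ multiply (+ ℓ) (+ k) _ _ _ _ ([1+k]*nC[1+k]≡[n-k]*nCk ℓ k) absorption ⟩
    (pronic ℓ - pronic k) * (+ (ℓ C k) * + ((ℓ ℕ.+ k) C k))
      ≡⟨ cong ((pronic ℓ - pronic k) *_) (pos-* (ℓ C k) _) ⟨
    (pronic ℓ - pronic k) * P k ℓ
      ∎
    where
    open ≡-Reasoning
    absorption : + suc k * + ((ℓ ℕ.+ suc k) C suc k) ≡ + suc (ℓ ℕ.+ k) * + ((ℓ ℕ.+ k) C k)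
    absorption rewrite ℕ.+-suc ℓ k =
      pos-*-≡ (suc k) (suc (ℓ ℕ.+ k) C suc k) (suc (ℓ ℕ.+ k)) ((ℓ ℕ.+ k) C k)
              ([1+k]*[1+n]C[1+k]≡[1+n]*nCk (ℓ ℕ.+ k) k)
    multiply : ∀ ℓ k a b a′ b′ →
               (1ℤ + k) * a′ ≡ (ℓ - k) * a → (1ℤ + k) * b′ ≡ (1ℤ + (ℓ + k)) * b →
               (1ℤ + k) * (1ℤ + k) * (a′ * b′) ≡ (ℓ * (1ℤ + ℓ) - k * (1ℤ + k)) * (a * b)
    multiply ℓ k a b a′ b′ eqa eqb = begin
      (1ℤ + k) * (1ℤ + k) * (a′ * b′)          ≡⟨ solve (ℓ ∷ k ∷ a ∷ b ∷ a′ ∷ b′ ∷ []) ⟩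
      ((1ℤ + k) * a′) * ((1ℤ + k) * b′)        ≡⟨ cong₂ _*_ eqa eqb ⟩
      ((ℓ - k) * a) * ((1ℤ + (ℓ + k)) * b)     ≡⟨ solve (ℓ ∷ k ∷ a ∷ b ∷ a′ ∷ b′ ∷ []) ⟩
      (ℓ * (1ℤ + ℓ) - k * (1ℤ + k)) * (a * b)  ∎

  -- At k = 0 the factor k * k annihilates the junk coefficient a (0 ∸ 1).
  pronic-*-expansion : ∀ {N} m ℓ (a : ℕ → ℤ) → a N ≡ 0ℤ →
    (pronic ℓ - pronic m) * ∑< (suc N) (λ k → a k * P k ℓ)
      ≡ ∑< (suc N) (λ k → (+ k * + k * a (k ∸ 1) + (pronic k - pronic m) * a k) * P k ℓ)
  pronic-*-expansion {N} m ℓ a aN≡0 = begin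
    (pronic ℓ - pronic m) * ∑< (suc N) (λ k → a k * P k ℓ)
      ≡⟨ *-distribˡ-sum {suc N} (pronic ℓ - pronic m) (λ i → a (toℕ i) * P (toℕ i) ℓ) ⟩
    ∑< (suc N) (λ k → (pronic ℓ - pronic m) * (a k * P k ℓ))
      ≡⟨ ∑<-cong {suc N} (λ k _ → split (pronic ℓ) (pronic k) (pronic m) (+ suc k) (a k) _ _
                                        (P-recurrence k ℓ)) ⟩
    ∑< (suc N) (λ k → raised k + stay k)
      ≡⟨ ∑-distrib-+ {suc N} (λ i → raised (toℕ i)) (λ i → stay (toℕ i)) ⟩
    ∑< (suc N) raised + ∑< (suc N) stay
      ≡⟨ cong (_+ ∑< (suc N) stay) lower ⟩
    ∑< (suc N) lowered + ∑< (suc N) stay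
      ≡⟨ ∑-distrib-+ {suc N} (λ i → lowered (toℕ i)) (λ i → stay (toℕ i)) ⟨
    ∑< (suc N) (λ k → lowered k + stay k)
      ≡⟨ ∑<-cong {suc N} (λ k _ → *-distribʳ-+ (P k ℓ) (+ k * + k * a (k ∸ 1))
                                                       ((pronic k - pronic m) * a k)) ⟨
    ∑< (suc N) (λ k → (+ k * + k * a (k ∸ 1) + (pronic k - pronic m) * a k) * P k ℓ)
      ∎
    where
    open ≡-Reasoning
    raised lowered stay : ℕ → ℤ
    raised k = + suc k * + suc k * a k * P (suc k) ℓ
    lowered k = + k * + k * a (k ∸ 1) * P k ℓ
    stay k = (pronic k - pronic m) * a k * P k ℓ

    split : ∀ x y z s a p p′ → s * s * p′ ≡ (x - y) * p →
            (x - z) * (a * p) ≡ s * s * a * p′ + (y - z) * a * p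
    split x y z s a p p′ eq = begin
      (x - z) * (a * p)                    ≡⟨ solve (x ∷ y ∷ z ∷ s ∷ a ∷ p ∷ p′ ∷ []) ⟩
      a * ((x - y) * p) + (y - z) * a * p  ≡⟨ cong (λ q → a * q + (y - z) * a * p) eq ⟨
      a * (s * s * p′) + (y - z) * a * p   ≡⟨ solve (x ∷ y ∷ z ∷ s ∷ a ∷ p ∷ p′ ∷ []) ⟩
      s * s * a * p′ + (y - z) * a * p     ∎

    -- lowered 0 reduces to 0ℤ and lowered ∘ suc to raised.
    lower : ∑< (suc N) raised ≡ ∑< (suc N) lowered
    lower = begin
      ∑< (suc N) raised
        ≡⟨ ∑<-last N raised ⟩
      ∑< N raised + raised N
        ≡⟨ cong (λ c → ∑< N raised + + suc N * + suc N * c * P (suc N) ℓ) aN≡0 ⟩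
      ∑< N raised + + suc N * + suc N * 0ℤ * P (suc N) ℓ
        ≡⟨ cong (λ c → ∑< N raised + c * P (suc N) ℓ) (*-zeroʳ (+ suc N * + suc N)) ⟩
      ∑< N raised + 0ℤ
        ≡⟨ +-identityʳ _ ⟩
      ∑< N raised
        ≡⟨ +-identityˡ _ ⟨
      ∑< (suc N) lowered
        ∎

  linCoeff : ℕ → ℕ → ℕ → ℤ
  linCoeff m n k = + (k C m) * + (k C n) * + ((m ℕ.+ n) C k)

  linCoeff-vanishes-above : ∀ m n {k} → m ℕ.+ n < k → linCoeff m n k ≡ 0ℤ
  linCoeff-vanishes-above m n {k} m+n<k rewrite k>n⇒nCk≡0 m+n<k = *-zeroʳ (+ (k C m) * + (k C n))

  linCoeff-vanishes-below : ∀ m n {k} → k < m → linCoeff m n k ≡ 0ℤ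
  linCoeff-vanishes-below m n k<m rewrite k>n⇒nCk≡0 k<m = refl

  linCoeff-zero-off-diagonal : ∀ {n k} → k ≢ n → linCoeff 0 n k ≡ 0ℤ
  linCoeff-zero-off-diagonal {n} {k} k≢n with ℕ.<-cmp k n
  ... | tri< k<n _ _ rewrite k>n⇒nCk≡0 k<n = refl
  ... | tri≈ _ k≡n _ = contradiction k≡n k≢n
  ... | tri> _ _ n<k rewrite k>n⇒nCk≡0 n<k = *-zeroʳ (+ 1 * + (k C n))

  linCoeff-recurrence : ∀ m n k →
    + k * + k * linCoeff m n (k ∸ 1) + (pronic k - pronic m) * linCoeff m n k
      ≡ + suc m * + suc m * linCoeff (suc m) n k
  linCoeff-recurrence zero    n zero = refl
  linCoeff-recurrence (suc m) n zero =
    trans (+-identityˡ ((pronic 0 - pronic (suc m)) * 0ℤ))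
          (trans (*-zeroʳ (pronic 0 - pronic (suc m))) (sym (*-zeroʳ (+ suc (suc m) * + suc (suc m)))))
  linCoeff-recurrence m n (suc j) =
    trans (combine (+ m) (+ n) (+ j) _ _ _ _ _ _ _
                   ([1+n]*nCk≡[1+n-k]*[1+n]Ck j m) ([1+n]*nCk≡[1+n-k]*[1+n]Ck j n)
                   ([1+k]*nC[1+k]≡[n-k]*nCk (m ℕ.+ n) j) ([1+k]*nC[1+k]≡[n-k]*nCk (suc j) m))
          (cong (λ z → + suc m * + suc m * (+ (suc j C suc m) * + (suc j C n) * + z))
                (nCk+nC[k+1]≡[n+1]C[k+1] (m ℕ.+ n) j))
    where
    combine : ∀ M N J A A′ B B′ D D′ G →
      (1ℤ + J) * A ≡ (1ℤ + J - M) * A′ → (1ℤ + J) * B ≡ (1ℤ + J - N) * B′ →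
      (1ℤ + J) * D′ ≡ (M + N - J) * D → (1ℤ + M) * G ≡ (1ℤ + J - M) * A′ →
      (1ℤ + J) * (1ℤ + J) * (A * B * D)
        + ((1ℤ + J) * (1ℤ + (1ℤ + J)) - M * (1ℤ + M)) * (A′ * B′ * D′)
        ≡ (1ℤ + M) * (1ℤ + M) * (G * B′ * (D + D′))
    combine M N J A A′ B B′ D D′ G eqA eqB eqD eqG = begin
      (1ℤ + J) * (1ℤ + J) * (A * B * D)
        + ((1ℤ + J) * (1ℤ + (1ℤ + J)) - M * (1ℤ + M)) * (A′ * B′ * D′)
        ≡⟨ solve (M ∷ N ∷ J ∷ A ∷ A′ ∷ B ∷ B′ ∷ D ∷ D′ ∷ G ∷ []) ⟩
      ((1ℤ + J) * A) * ((1ℤ + J) * B) * D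
        + ((1ℤ + J) * (1ℤ + (1ℤ + J)) - M * (1ℤ + M)) * (A′ * B′ * D′)
        ≡⟨ cong₂ (λ a b → a * b * D + ((1ℤ + J) * (1ℤ + (1ℤ + J)) - M * (1ℤ + M)) * (A′ * B′ * D′))
                 eqA eqB ⟩
      ((1ℤ + J - M) * A′) * ((1ℤ + J - N) * B′) * D
        + ((1ℤ + J) * (1ℤ + (1ℤ + J)) - M * (1ℤ + M)) * (A′ * B′ * D′)
        ≡⟨ solve (M ∷ N ∷ J ∷ A ∷ A′ ∷ B ∷ B′ ∷ D ∷ D′ ∷ G ∷ []) ⟩
      (1ℤ + J - M) * A′ * B′ * ((1ℤ + M) * (D + D′) + ((1ℤ + J) * D′ - (M + N - J) * D))
        ≡⟨ cong (λ d → (1ℤ + J - M) * A′ * B′ * ((1ℤ + M) * (D + D′) + (d - (M + N - J) * D))) eqD ⟩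
      (1ℤ + J - M) * A′ * B′ * ((1ℤ + M) * (D + D′) + ((M + N - J) * D - (M + N - J) * D))
        ≡⟨ solve (M ∷ N ∷ J ∷ A ∷ A′ ∷ B ∷ B′ ∷ D ∷ D′ ∷ G ∷ []) ⟩
      (1ℤ + M) * ((1ℤ + J - M) * A′) * (B′ * (D + D′))
        ≡⟨ cong (λ g → (1ℤ + M) * g * (B′ * (D + D′))) eqG ⟨
      (1ℤ + M) * ((1ℤ + M) * G) * (B′ * (D + D′))
        ≡⟨ solve (M ∷ N ∷ J ∷ A ∷ A′ ∷ B ∷ B′ ∷ D ∷ D′ ∷ G ∷ []) ⟩
      (1ℤ + M) * (1ℤ + M) * (G * B′ * (D + D′))
        ∎
      where open ≡-Reasoning

  P-linearisation : ∀ m n {N} ℓ → m ℕ.+ n < N → P m ℓ * P n ℓ ≡ ∑< N (λ k → linCoeff m n k * P k ℓ)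
  P-linearisation zero n {N} ℓ n<N = sym (begin
    ∑< N (λ k → linCoeff 0 n k * P k ℓ)
      ≡⟨ ∑<-single n _ n<N (λ k k≢n → cong (_* P k ℓ) (linCoeff-zero-off-diagonal k≢n)) ⟩
    + 1 * + (n C n) * + (n C n) * P n ℓ
      ≡⟨ cong (λ c → + 1 * + c * + c * P n ℓ) (nCn≡1 n) ⟩
    1ℤ * P n ℓ
      ∎)
    where open ≡-Reasoning
  P-linearisation (suc m) n {suc N} ℓ (s≤s m+n<N) = *-cancelˡ-≡ (+ suc m * + suc m) _ _ (begin
    + suc m * + suc m * (P (suc m) ℓ * P n ℓ)
      ≡⟨ *-assoc (+ suc m * + suc m) (P (suc m) ℓ) (P n ℓ) ⟨
    + suc m * + suc m * P (suc m) ℓ * P n ℓ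
      ≡⟨ cong (_* P n ℓ) (P-recurrence m ℓ) ⟩
    (pronic ℓ - pronic m) * P m ℓ * P n ℓ
      ≡⟨ *-assoc (pronic ℓ - pronic m) (P m ℓ) (P n ℓ) ⟩
    (pronic ℓ - pronic m) * (P m ℓ * P n ℓ)
      ≡⟨ cong ((pronic ℓ - pronic m) *_) (P-linearisation m n ℓ (ℕ.m<n⇒m<1+n m+n<N)) ⟩
    (pronic ℓ - pronic m) * ∑< (suc N) (λ k → linCoeff m n k * P k ℓ)
      ≡⟨ pronic-*-expansion {N} m ℓ (linCoeff m n) (linCoeff-vanishes-above m n m+n<N) ⟩
    ∑< (suc N) (λ k → (+ k * + k * linCoeff m n (k ∸ 1) + (pronic k - pronic m) * linCoeff m n k)
                      * P k ℓ)
      ≡⟨ ∑<-cong {suc N} (λ k _ → cong (_* P k ℓ) (linCoeff-recurrence m n k)) ⟩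
    ∑< (suc N) (λ k → + suc m * + suc m * linCoeff (suc m) n k * P k ℓ)
      ≡⟨ ∑<-cong {suc N} (λ k _ → *-assoc (+ suc m * + suc m) (linCoeff (suc m) n k) (P k ℓ)) ⟩
    ∑< (suc N) (λ k → + suc m * + suc m * (linCoeff (suc m) n k * P k ℓ))
      ≡⟨ *-distribˡ-sum {suc N} (+ suc m * + suc m) (λ i → linCoeff (suc m) n (toℕ i) * P (toℕ i) ℓ) ⟨
    + suc m * + suc m * ∑< (suc N) (λ k → linCoeff (suc m) n k * P k ℓ)
      ∎)
    where open ≡-Reasoning

  P-*-expansion : ∀ m {M N} ℓ (α : ℕ → ℤ) → m ℕ.+ M ≤ N →
    P m ℓ * ∑< M (λ j → α j * P j ℓ) ≡ ∑< N (λ k → ∑< M (λ j → α j * linCoeff m j k) * P k ℓ)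
  P-*-expansion m {M} {N} ℓ α m+M≤N = begin
    P m ℓ * ∑< M (λ j → α j * P j ℓ)
      ≡⟨ *-distribˡ-sum {M} (P m ℓ) (λ i → α (toℕ i) * P (toℕ i) ℓ) ⟩
    ∑< M (λ j → P m ℓ * (α j * P j ℓ))
      ≡⟨ ∑<-cong {M} expand ⟩
    ∑< M (λ j → ∑< N (λ k → α j * (linCoeff m j k * P k ℓ)))
      ≡⟨ ∑-comm {M} {N} (λ i i′ → α (toℕ i) * (linCoeff m (toℕ i) (toℕ i′) * P (toℕ i′) ℓ)) ⟩
    ∑< N (λ k → ∑< M (λ j → α j * (linCoeff m j k * P k ℓ)))
      ≡⟨ ∑<-cong {N} (λ k _ → collect k) ⟩
    ∑< N (λ k → ∑< M (λ j → α j * linCoeff m j k) * P k ℓ)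
      ∎
    where
    open ≡-Reasoning
    expand : ∀ j → j < M → P m ℓ * (α j * P j ℓ) ≡ ∑< N (λ k → α j * (linCoeff m j k * P k ℓ))
    expand j j<M = begin
      P m ℓ * (α j * P j ℓ)
        ≡⟨ x∙yz≈y∙xz *-commutativeSemigroup (P m ℓ) (α j) (P j ℓ) ⟩
      α j * (P m ℓ * P j ℓ)
        ≡⟨ cong (α j *_) (P-linearisation m j ℓ (ℕ.<-≤-trans (ℕ.+-monoʳ-< m j<M) m+M≤N)) ⟩
      α j * ∑< N (λ k → linCoeff m j k * P k ℓ)
        ≡⟨ *-distribˡ-sum {N} (α j) (λ i → linCoeff m j (toℕ i) * P (toℕ i) ℓ) ⟩
      ∑< N (λ k → α j * (linCoeff m j k * P k ℓ))
        ∎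
    collect : ∀ k → ∑< M (λ j → α j * (linCoeff m j k * P k ℓ))
                    ≡ ∑< M (λ j → α j * linCoeff m j k) * P k ℓ
    collect k = trans (∑<-cong {M} (λ j _ → sym (*-assoc (α j) (linCoeff m j k) (P k ℓ))))
                      (sym (*-distribʳ-sum {M} (P k ℓ) (λ i → α (toℕ i) * linCoeff m (toℕ i) k)))

  powerCoeff : ℕ → ℕ → ℕ → ℤ
  powerCoeff m zero    zero    = 1ℤ
  powerCoeff m zero    (suc k) = 0ℤ
  powerCoeff m (suc s) k       = ∑< (suc (s ℕ.* m)) (λ j → powerCoeff m s j * linCoeff m j k)

  power-expansion : ∀ m s {N} ℓ → s ℕ.* m < N →
    + (((ℓ C m) ℕ.* ((ℓ ℕ.+ m) C m)) ℕ.^ s) ≡ ∑< N (λ k → powerCoeff m s k * P k ℓ)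
  power-expansion m zero {N} ℓ 0<N = sym (∑<-single 0 _ 0<N off)
    where
    off : ∀ k → k ≢ 0 → powerCoeff m zero k * P k ℓ ≡ 0ℤ
    off zero    0≢0 = contradiction refl 0≢0
    off (suc k) _   = refl
  power-expansion m (suc s) {N} ℓ [1+s]m<N = begin
    + (x ℕ.* x ℕ.^ s)
      ≡⟨ pos-* x (x ℕ.^ s) ⟩
    P m ℓ * + (x ℕ.^ s)
      ≡⟨ cong (P m ℓ *_) (power-expansion m s ℓ (ℕ.n<1+n (s ℕ.* m))) ⟩
    P m ℓ * ∑< (suc (s ℕ.* m)) (λ j → powerCoeff m s j * P j ℓ)
      ≡⟨ P-*-expansion m ℓ (powerCoeff m s) (subst (_≤ N) (sym (ℕ.+-suc m (s ℕ.* m))) [1+s]m<N) ⟩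
    ∑< N (λ k → powerCoeff m (suc s) k * P k ℓ)
      ∎
    where
    open ≡-Reasoning
    x = (ℓ C m) ℕ.* ((ℓ ℕ.+ m) C m)

  powerCoeff-vanishes-below : ∀ m s {k} → k < m → powerCoeff m (suc s) k ≡ 0ℤ
  powerCoeff-vanishes-below m s k<m = ∑<-zero {suc (s ℕ.* m)} (λ j _ →
    trans (cong (powerCoeff m s j *_) (linCoeff-vanishes-below m j k<m)) (*-zeroʳ (powerCoeff m s j)))

open import Defs
open import Data.Nat using (ℕ; _≤_; _+_; _*_; _^_)
open import Data.Nat.Combinatorics using (_C_)
open import Data.Integer using (ℤ; +_) renaming (_*_ to _*ℤ_)
open import Data.Product using (Σ)
open import Relation.Binary.PropositionalEquality using (_≡_)

open import Algebra.Properties.CommutativeSemigroup using (interchange)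
open import Data.Nat using (zero; suc; s≤s)
open import Data.Nat.Properties using (*-commutativeSemigroup; m≤n⇒m≤1+n; m≤m+n; n<1+n)
open import Data.Product using (_,_)
open import Relation.Binary.PropositionalEquality using (refl; cong; trans; module ≡-Reasoning)
open Linearisation using (∑<; P; powerCoeff; power-expansion; powerCoeff-vanishes-below; ∑<-sumFromTo)

^-distribʳ-* : ∀ a b r → (a * b) ^ r ≡ a ^ r * b ^ r
^-distribʳ-* a b zero    = refl
^-distribʳ-* a b (suc r) =
  trans (cong (a * b *_) (^-distribʳ-* a b r)) (interchange *-commutativeSemigroup a b (a ^ r) (b ^ r))

lemma4p2 : ∀ (r : ℕ) → 2 ≤ r → ∀ (m : ℕ) →
    Σ (ℕ → ℤ) λ a → (∀ (ℓ : ℕ) →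
      + (((ℓ C m) ^ r) * (((ℓ + m) C m) ^ r))
        ≡ sumFromTo m (r * m) (λ k → a k *ℤ + ((ℓ C k) * ((ℓ + k) C k))))
lemma4p2 r@(suc s) (s≤s _) m = powerCoeff m r , λ ℓ → begin
  + ((ℓ C m) ^ r * ((ℓ + m) C m) ^ r)
    ≡⟨ cong +_ (^-distribʳ-* (ℓ C m) ((ℓ + m) C m) r) ⟨
  + (((ℓ C m) * ((ℓ + m) C m)) ^ r)
    ≡⟨ power-expansion m r ℓ (n<1+n (r * m)) ⟩
  ∑< (suc (r * m)) (λ k → powerCoeff m r k *ℤ P k ℓ)
    ≡⟨ ∑<-sumFromTo _ (m≤n⇒m≤1+n (m≤m+n m (s * m)))
                      (λ k k<m → cong (_*ℤ P k ℓ) (powerCoeff-vanishes-below m s k<m)) ⟩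
  sumFromTo m (r * m) (λ k → powerCoeff m r k *ℤ P k ℓ)
    ∎
  where open ≡-Reasoning
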